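{- Let $M\subseteq B$ be semisimple (finite-dimensional) $\mathbb{Q}$-algebras and $\pi$ a central idempotent of $B$ such that $B=M[\pi]$ (the subalgebra generated by $M$ and $\pi$). Let $V$ be a $\mathbb{Q}$-vector space with a faithful action of $B$, let $u$ be an idempotent of $B$, and let $I=uB+\pi B\subseteq B$. Then an element $b\in B$ belongs to $I$ if and only if $b\cdot V+\pi\cdot V\subseteq u\cdot V+\pi\cdot V$. -}

module Defs where

open import Level using (0ℓ)
open import Data.Nat using (ℕ)
open import Data.Fin as Fin using (Fin)
open import Data.Product using (Σ; ∃; ∃-syntax; _×_; _,_)
open import Data.Rational as ℚ using (ℚ)
open import Data.Rational.Properties using (+-*-ring)
open import Algebra.Bundles using (Ring)
open import Algebra.Module.Bundles using (LeftModule)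
open import Function.Bundles using (_⇔_)

ℚ-ring : Ring 0ℓ 0ℓ
ℚ-ring = +-*-ring

VectorSpaceℚ : Set₁
VectorSpaceℚ = LeftModule ℚ-ring 0ℓ 0ℓ

record QAlgebra : Set₁ where
  infixr 7 _·_
  field
    ring : Ring 0ℓ 0ℓ
  open Ring ring public
  field
    _·_        : ℚ → Carrier → Carrier
    ·-cong     : ∀ q {a b} → a ≈ b → q · a ≈ q · b
    ·-distribˡ : ∀ q a b → q · (a + b) ≈ q · a + q · b
    ·-distribʳ : ∀ p q a → (p ℚ.+ q) · a ≈ p · a + q · a
    ·-assoc    : ∀ p q a → (p ℚ.* q) · a ≈ p · (q · a)
    ·-identity : ∀ a → ℚ.1ℚ · a ≈ a
    ·-*-assocˡ : ∀ q a b → (q · a) * b ≈ q · (a * b)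
    ·-*-assocʳ : ∀ q a b → a * (q · b) ≈ q · (a * b)

  lincomb : ∀ {n} → (Fin n → ℚ) → (Fin n → Carrier) → Carrier
  lincomb {ℕ.zero}  c e = 0#
  lincomb {ℕ.suc n} c e = c Fin.zero · e Fin.zero + lincomb (λ i → c (Fin.suc i)) (λ i → e (Fin.suc i))

  FiniteDimensional : Set
  FiniteDimensional =
    ∃[ n ] Σ (Fin n → Carrier) λ e → ∀ a → Σ (Fin n → ℚ) λ c → a ≈ lincomb c e

  record IsLeftIdeal (L : Carrier → Set) : Set where
    field
      resp  : ∀ {a b} → a ≈ b → L a → L b
      zero∈ : L 0#
      +∈    : ∀ {a b} → L a → L b → L (a + b)
      *∈    : ∀ x {a} → L a → L (x * a)

  -- semisimple: A is semisimple as a left module over itself, i.e.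
  -- every left ideal has a complementary left ideal.
  Semisimple : Set₁
  Semisimple =
    ∀ (L : Carrier → Set) → IsLeftIdeal L →
      Σ (Carrier → Set) λ L′ → IsLeftIdeal L′
        × (∀ a → L a → L′ a → a ≈ 0#)
        × (∀ a → ∃[ x ] ∃[ y ] (L x × L′ y × a ≈ x + y))

  IsFDSemisimple : Set₁
  IsFDSemisimple = FiniteDimensional × Semisimple

  Idempotent : Carrier → Set
  Idempotent e = e * e ≈ e

  Central : Carrier → Set
  Central z = ∀ x → z * x ≈ x * z

record AlgEmbedding (M B : QAlgebra) : Set where
  private
    module M = QAlgebra M
    module B = QAlgebra B
  field
    ⟦_⟧     : M.Carrier → B.Carrier
    cong    : ∀ {a b} → a M.≈ b → ⟦ a ⟧ B.≈ ⟦ b ⟧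
    hom-+   : ∀ a b → ⟦ a M.+ b ⟧ B.≈ ⟦ a ⟧ B.+ ⟦ b ⟧
    hom-*   : ∀ a b → ⟦ a M.* b ⟧ B.≈ ⟦ a ⟧ B.* ⟦ b ⟧
    hom-1   : ⟦ M.1# ⟧ B.≈ B.1#
    hom-·   : ∀ q a → ⟦ q M.· a ⟧ B.≈ q B.· ⟦ a ⟧
    injective : ∀ {a b} → ⟦ a ⟧ B.≈ ⟦ b ⟧ → a M.≈ b

module _ {M B : QAlgebra} (ι : AlgEmbedding M B) (π : QAlgebra.Carrier B) where
  open QAlgebra B
  open AlgEmbedding ι

  data Generated : Carrier → Set where
    gen-M : ∀ m → Generated ⟦ m ⟧
    gen-π : Generated π
    gen-1 : Generated 1#
    gen-+ : ∀ {a b} → Generated a → Generated b → Generated (a + b)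
    gen-* : ∀ {a b} → Generated a → Generated b → Generated (a * b)
    gen-· : ∀ q {a} → Generated a → Generated (q · a)
    gen-≈ : ∀ {a b} → a ≈ b → Generated a → Generated b

  GeneratedBy : Set
  GeneratedBy = ∀ b → Generated b

record Action (B : QAlgebra) (V : VectorSpaceℚ) : Set where
  private
    module B = QAlgebra B
    module V = LeftModule V
  infixr 7 _▷_
  field
    _▷_      : B.Carrier → V.Carrierᴹ → V.Carrierᴹ
    ▷-cong   : ∀ {a b v w} → a B.≈ b → v V.≈ᴹ w → (a ▷ v) V.≈ᴹ (b ▷ w)
    ▷-distribˡ : ∀ a v w → (a ▷ (v V.+ᴹ w)) V.≈ᴹ (a ▷ v) V.+ᴹ (a ▷ w)
    ▷-distribʳ : ∀ a b v → ((a B.+ b) ▷ v) V.≈ᴹ (a ▷ v) V.+ᴹ (b ▷ v)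
    ▷-assoc  : ∀ a b v → ((a B.* b) ▷ v) V.≈ᴹ (a ▷ (b ▷ v))
    ▷-identity : ∀ v → (B.1# ▷ v) V.≈ᴹ v
    ▷-scalarˡ : ∀ q a v → ((q B.· a) ▷ v) V.≈ᴹ (q V.*ₗ (a ▷ v))
    ▷-scalarʳ : ∀ q a v → (a ▷ (q V.*ₗ v)) V.≈ᴹ (q V.*ₗ (a ▷ v))

  Faithful : Set
  Faithful = ∀ b → (∀ v → (b ▷ v) V.≈ᴹ V.0ᴹ) → b B.≈ B.0#

module _ (B : QAlgebra) where
  open QAlgebra B
  ∈uB+πB : (u π b : Carrier) → Set
  ∈uB+πB u π b = ∃[ x ] ∃[ y ] (b ≈ u * x + π * y)

module _ {B : QAlgebra} {V : VectorSpaceℚ} (ρ : Action B V) where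
  open Action ρ
  open LeftModule V

  bV+πV⊆uV+πV : (b π u : QAlgebra.Carrier B) → Set
  bV+πV⊆uV+πV b π u =
    ∀ v w → ∃[ v₁ ] ∃[ v₂ ] ((b ▷ v) +ᴹ (π ▷ w)) ≈ᴹ ((u ▷ v₁) +ᴹ (π ▷ v₂))

{-# OPTIONS --safe #-}

-- Over a semisimple algebra every element a is von Neumann regular, a = a c a.
-- Put q = 1 - π and apply this to a = q u: then k = q - (a c) q annihilates
-- both u and π from the left, hence kills u·V + π·V, hence kills b·V, and by
-- faithfulness k b = 0.  Unfolding, q b = q u (c q b), and splitting
-- b = π b + q b exhibits b ∈ uB + πB.

module Submission where

open import Level using (Level; _⊔_)
open import Data.Product using (∃-syntax; _,_)
open import Function.Bundles using (_⇔_; mk⇔)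
open import Algebra.Bundles using (Ring)
open import Algebra.Module.Bundles using (LeftModule)
import Algebra.Properties.Ring as RingProperties
import Algebra.Properties.AbelianGroup as AbelianGroupProperties
import Relation.Binary.Reasoning.Setoid as SetoidReasoning

open import Defs

module _ {c ℓ : Level} (R : Ring c ℓ) where
  open Ring R
  open RingProperties R
  open SetoidReasoning setoid

  VonNeumannRegular : Set (c ⊔ ℓ)
  VonNeumannRegular = ∀ a → ∃[ x ] a ≈ a * x * a

  [1-e]e≈0 : ∀ {e} → e * e ≈ e → (1# - e) * e ≈ 0#
  [1-e]e≈0 {e} e² = begin
    (1# - e) * e    ≈⟨ [y-z]x≈yx-zx e 1# e ⟩
    1# * e - e * e  ≈⟨ +-cong (*-identityˡ e) (-‿cong e²) ⟩
    e - e           ≈⟨ -‿inverseʳ e ⟩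
    0#              ∎

  ≈-from-complement : ∀ e b w → (1# - e) * b ≈ (1# - e) * w → b ≈ w + e * (b - w)
  ≈-from-complement e b w eq = begin
    b                ≈⟨ +-identityˡ b ⟨
    0# + b           ≈⟨ +-congʳ (-‿inverseʳ w) ⟨
    (w - w) + b      ≈⟨ +-assoc w (- w) b ⟩
    w + (- w + b)    ≈⟨ +-congˡ (+-comm (- w) b) ⟩
    w + (b - w)      ≈⟨ +-congˡ b-w≈e[b-w] ⟩
    w + e * (b - w)  ∎
    where
    [1-e][b-w]≈0 : (1# - e) * (b - w) ≈ 0#
    [1-e][b-w]≈0 = begin
      (1# - e) * (b - w)              ≈⟨ x[y-z]≈xy-xz (1# - e) b w ⟩
      (1# - e) * b - (1# - e) * w     ≈⟨ x≈y⇒x∙y⁻¹≈ε eq ⟩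
      0#                              ∎
    b-w≈e[b-w] : b - w ≈ e * (b - w)
    b-w≈e[b-w] = x∙y⁻¹≈ε⇒x≈y (b - w) (e * (b - w)) (begin
      (b - w) - e * (b - w)          ≈⟨ +-congʳ (*-identityˡ (b - w)) ⟨
      1# * (b - w) - e * (b - w)     ≈⟨ [y-z]x≈yx-zx (b - w) 1# e ⟨
      (1# - e) * (b - w)             ≈⟨ [1-e][b-w]≈0 ⟩
      0#                             ∎)

  left-annihilators⇒∈uR+eR : VonNeumannRegular → ∀ {e} → e * e ≈ e → ∀ u b →
    (∀ k → k * u ≈ 0# → k * e ≈ 0# → k * b ≈ 0#) →
    ∃[ x ] ∃[ y ] b ≈ u * x + e * y
  left-annihilators⇒∈uR+eR regular {e} e² u b annihilated
    with regular ((1# - e) * u)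
  ... | c , a≈aca = z , b - u * z , ≈-from-complement e b (u * z) qb≈quz
    where
    q a p k z : Carrier
    q = 1# - e
    a = q * u
    p = a * c
    k = q - p * q
    z = c * (q * b)

    ku≈0 : k * u ≈ 0#
    ku≈0 = begin
      k * u              ≈⟨ [y-z]x≈yx-zx u q (p * q) ⟩
      a - (p * q) * u    ≈⟨ +-congˡ (-‿cong (*-assoc p q u)) ⟩
      a - p * a          ≈⟨ +-congˡ (-‿cong a≈aca) ⟨
      a - a              ≈⟨ -‿inverseʳ a ⟩
      0#                 ∎

    ke≈0 : k * e ≈ 0#
    ke≈0 = begin
      k * e              ≈⟨ [y-z]x≈yx-zx e q (p * q) ⟩
      q * e - p * q * e  ≈⟨ +-cong ([1-e]e≈0 e²) (-‿cong (*-assoc p q e)) ⟩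
      0# - p * (q * e)   ≈⟨ +-congˡ (-‿cong (*-congˡ ([1-e]e≈0 e²))) ⟩
      0# - p * 0#        ≈⟨ +-congˡ (-‿cong (zeroʳ p)) ⟩
      0# - 0#            ≈⟨ -‿inverseʳ 0# ⟩
      0#                 ∎

    qb≈quz : q * b ≈ q * (u * z)
    qb≈quz = begin
      q * b              ≈⟨ x∙y⁻¹≈ε⇒x≈y (q * b) (p * q * b) qb-pqb≈0 ⟩
      p * q * b          ≈⟨ *-assoc p q b ⟩
      a * c * (q * b)    ≈⟨ *-assoc a c (q * b) ⟩
      q * u * z          ≈⟨ *-assoc q u z ⟩
      q * (u * z)        ∎
      where
      qb-pqb≈0 : q * b - p * q * b ≈ 0#
      qb-pqb≈0 = trans (sym ([y-z]x≈yx-zx b q (p * q))) (annihilated k ku≈0 ke≈0)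

module _ (A : QAlgebra) where
  open QAlgebra A
  open RingProperties ring
  open SetoidReasoning setoid

  principal : Carrier → Carrier → Set
  principal a z = ∃[ r ] z ≈ r * a

  principal-isLeftIdeal : ∀ a → IsLeftIdeal (principal a)
  principal-isLeftIdeal a = record
    { resp  = λ { z≈w (r , z≈ra) → r , trans (sym z≈w) z≈ra }
    ; zero∈ = 0# , sym (zeroˡ a)
    ; +∈    = λ { (r , p) (s , q) → r + s , trans (+-cong p q) (sym (distribʳ a r s)) }
    ; *∈    = λ { x (r , p) → x * r , trans (*-congˡ p) (sym (*-assoc x r a)) }
    }

  -- Split 1 = r a + y along Aa ⊕ L′; then a y lies in both Aa and L′, so a y = 0.
  semisimple⇒regular : Semisimple → VonNeumannRegular ring
  semisimple⇒regular semisimple a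
    with semisimple (principal a) (principal-isLeftIdeal a)
  ... | L′ , L′-isLeftIdeal , disjoint , span
    with span 1#
  ... | x , y , (r , x≈ra) , y∈L′ , 1≈x+y = r , x∙y⁻¹≈ε⇒x≈y a (a * r * a) a-ara≈0
    where
    open IsLeftIdeal L′-isLeftIdeal using (*∈)

    ay≈a-ara : a * y ≈ a - a * r * a
    ay≈a-ara = begin
      a * y             ≈⟨ *-congˡ (x≈z//y y x 1# (trans (+-comm y x) (sym 1≈x+y))) ⟩
      a * (1# - x)      ≈⟨ x[y-z]≈xy-xz a 1# x ⟩
      a * 1# - a * x    ≈⟨ +-cong (*-identityʳ a) (-‿cong (*-congˡ x≈ra)) ⟩
      a - a * (r * a)   ≈⟨ +-congˡ (-‿cong (*-assoc a r a)) ⟨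
      a - a * r * a     ∎

    ay∈Aa : principal a (a * y)
    ay∈Aa = 1# - a * r , (begin
      a * y               ≈⟨ ay≈a-ara ⟩
      a - a * r * a       ≈⟨ +-congʳ (*-identityˡ a) ⟨
      1# * a - a * r * a  ≈⟨ [y-z]x≈yx-zx a 1# (a * r) ⟨
      (1# - a * r) * a    ∎)

    a-ara≈0 : a - a * r * a ≈ 0#
    a-ara≈0 = trans (sym ay≈a-ara) (disjoint (a * y) ay∈Aa (*∈ a y∈L′))

module _ {B : QAlgebra} {V : VectorSpaceℚ} (ρ : Action B V) where
  open Action ρ
  open LeftModule V
  open AbelianGroupProperties +ᴹ-abelianGroup using (identityˡ-unique)
  open SetoidReasoning ≈ᴹ-setoid
  private module B = QAlgebra B

  ▷-zeroʳ : ∀ a → a ▷ 0ᴹ ≈ᴹ 0ᴹ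
  ▷-zeroʳ a = identityˡ-unique (a ▷ 0ᴹ) (a ▷ 0ᴹ) (begin
    (a ▷ 0ᴹ) +ᴹ (a ▷ 0ᴹ)  ≈⟨ ▷-distribˡ a 0ᴹ 0ᴹ ⟨
    a ▷ (0ᴹ +ᴹ 0ᴹ)        ≈⟨ ▷-cong B.refl (+ᴹ-identityˡ 0ᴹ) ⟩
    a ▷ 0ᴹ                ∎)

  ▷-zeroˡ : ∀ v → B.0# ▷ v ≈ᴹ 0ᴹ
  ▷-zeroˡ v = identityˡ-unique (B.0# ▷ v) (B.0# ▷ v) (begin
    (B.0# ▷ v) +ᴹ (B.0# ▷ v)  ≈⟨ ▷-distribʳ B.0# B.0# v ⟨
    (B.0# B.+ B.0#) ▷ v       ≈⟨ ▷-cong (B.+-identityˡ B.0#) ≈ᴹ-refl ⟩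
    B.0# ▷ v                  ∎)

  ∈uB+πB⇒bV+πV⊆uV+πV : ∀ {u π b} → ∈uB+πB B u π b → bV+πV⊆uV+πV ρ b π u
  ∈uB+πB⇒bV+πV⊆uV+πV {u} {π} {b} (x , y , b≈ux+πy) v w = x ▷ v , (y ▷ v) +ᴹ w , (begin
    (b ▷ v) +ᴹ (π ▷ w)                                ≈⟨ +ᴹ-cong (▷-cong b≈ux+πy ≈ᴹ-refl) ≈ᴹ-refl ⟩
    ((u B.* x B.+ π B.* y) ▷ v) +ᴹ (π ▷ w)            ≈⟨ +ᴹ-cong (▷-distribʳ _ _ v) ≈ᴹ-refl ⟩
    (((u B.* x) ▷ v) +ᴹ ((π B.* y) ▷ v)) +ᴹ (π ▷ w)   ≈⟨ +ᴹ-assoc _ _ _ ⟩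
    ((u B.* x) ▷ v) +ᴹ (((π B.* y) ▷ v) +ᴹ (π ▷ w))   ≈⟨ +ᴹ-cong (▷-assoc u x v) (+ᴹ-cong (▷-assoc π y v) ≈ᴹ-refl) ⟩
    (u ▷ (x ▷ v)) +ᴹ ((π ▷ (y ▷ v)) +ᴹ (π ▷ w))       ≈⟨ +ᴹ-cong ≈ᴹ-refl (▷-distribˡ π _ _) ⟨
    (u ▷ (x ▷ v)) +ᴹ (π ▷ ((y ▷ v) +ᴹ w))             ∎)

  ▷-annihilates-uV+πV : ∀ {k u π} → k B.* u B.≈ B.0# → k B.* π B.≈ B.0# →
    ∀ v₁ v₂ → k ▷ ((u ▷ v₁) +ᴹ (π ▷ v₂)) ≈ᴹ 0ᴹ
  ▷-annihilates-uV+πV {k} {u} {π} ku≈0 kπ≈0 v₁ v₂ = begin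
    k ▷ ((u ▷ v₁) +ᴹ (π ▷ v₂))              ≈⟨ ▷-distribˡ k _ _ ⟩
    (k ▷ (u ▷ v₁)) +ᴹ (k ▷ (π ▷ v₂))        ≈⟨ +ᴹ-cong (▷-assoc k u v₁) (▷-assoc k π v₂) ⟨
    ((k B.* u) ▷ v₁) +ᴹ ((k B.* π) ▷ v₂)    ≈⟨ +ᴹ-cong (▷-cong ku≈0 ≈ᴹ-refl) (▷-cong kπ≈0 ≈ᴹ-refl) ⟩
    (B.0# ▷ v₁) +ᴹ (B.0# ▷ v₂)              ≈⟨ +ᴹ-cong (▷-zeroˡ v₁) (▷-zeroˡ v₂) ⟩
    0ᴹ +ᴹ 0ᴹ                                ≈⟨ +ᴹ-identityˡ 0ᴹ ⟩
    0ᴹ                                      ∎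

  bV+πV⊆uV+πV⇒left-annihilators : Faithful → ∀ {u π b} → bV+πV⊆uV+πV ρ b π u →
    ∀ k → k B.* u B.≈ B.0# → k B.* π B.≈ B.0# → k B.* b B.≈ B.0#
  bV+πV⊆uV+πV⇒left-annihilators faithful {u} {π} {b} ⊆ k ku≈0 kπ≈0 = faithful (k B.* b) kb▷≈0
    where
    kb▷≈0 : ∀ v → (k B.* b) ▷ v ≈ᴹ 0ᴹ
    kb▷≈0 v with ⊆ v 0ᴹ
    ... | v₁ , v₂ , bv+π0≈uv₁+πv₂ = begin
      (k B.* b) ▷ v                ≈⟨ ▷-assoc k b v ⟩
      k ▷ (b ▷ v)                  ≈⟨ ▷-cong B.refl (+ᴹ-identityʳ _) ⟨
      k ▷ ((b ▷ v) +ᴹ 0ᴹ)          ≈⟨ ▷-cong B.refl (+ᴹ-congˡ (▷-zeroʳ π)) ⟨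
      k ▷ ((b ▷ v) +ᴹ (π ▷ 0ᴹ))    ≈⟨ ▷-cong B.refl bv+π0≈uv₁+πv₂ ⟩
      k ▷ ((u ▷ v₁) +ᴹ (π ▷ v₂))   ≈⟨ ▷-annihilates-uV+πV ku≈0 kπ≈0 v₁ v₂ ⟩
      0ᴹ                           ∎

lemma5p6 : (M B : QAlgebra) → QAlgebra.IsFDSemisimple M → QAlgebra.IsFDSemisimple B →
           (ι : AlgEmbedding M B) (π : QAlgebra.Carrier B) →
           QAlgebra.Idempotent B π → QAlgebra.Central B π → GeneratedBy ι π →
           (V : VectorSpaceℚ) (ρ : Action B V) → Action.Faithful ρ →
           (u : QAlgebra.Carrier B) → QAlgebra.Idempotent B u →
           (b : QAlgebra.Carrier B) →
           ∈uB+πB B u π b ⇔ bV+πV⊆uV+πV ρ b π u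
lemma5p6 M B _ (_ , B-semisimple) ι π π² _ _ V ρ faithful u _ b =
  mk⇔ (∈uB+πB⇒bV+πV⊆uV+πV ρ)
      (λ ⊆ → left-annihilators⇒∈uR+eR (QAlgebra.ring B) (semisimple⇒regular B B-semisimple) π² u b
               (bV+πV⊆uV+πV⇒left-annihilators ρ faithful ⊆))
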